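{- Let $k \in \mathbb{N}=\{1,2,\dots\}$ and let $Y$ be a Young diagram. Then $Y$ can be covered by a set $C$ of generalized rectangles such that each row and each column of $Y$ is used by at most $k$ rectangles in $C$ if and only if $Y$ has strictly fewer than $\binom{2k}{k}$ steps.
   Context: For $x\in\mathbb{N}$ let $[x]=\{1,\dots,x\}$. A Young diagram with $r$ rows and $c$ columns is a set $Y\subseteq [r]\times[c]$ such that whenever $(i,j)\in Y$, then $(i-1,j)\in Y$ if $i\ge 2$ and $(i,j-1)\in Y$ if $j\ge 2$; elements of $Y$ are called cells, row $s$ consists of the cells $(s,\cdot)$ and column $t$ of the cells $(\cdot,t)$. A generalized rectangle in $Y$ is a set $R=S\times T$ with $S\subseteq[r]$, $T\subseteq[c]$ and $R\subseteq Y$; it uses the rows in $S$ and the columns in $T$. A set $C$ of generalized rectangles covers $Y$ if $Y=\bigcup_{R\in C}R$. The steps of $Y$ are the cells of $Z=\{(s,t)\in Y : (s+1,t)\notin Y \text{ and } (s,t+1)\notin Y\}$; the number of steps equals the number of distinct row lengths of $Y$. -}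

module Defs where

open import Data.Nat using (ℕ; zero; suc; _≤_; _<_)
open import Data.Nat.Properties using (_<?_)
open import Data.Bool using (Bool; true; false; not; _∧_)
open import Data.Fin using (Fin; fromℕ<; toℕ)
open import Data.Fin.Subset using (Subset; _∈_)
open import Data.Vec using (lookup)
open import Data.List using (List; length; filterᵇ; allFin; concatMap; map)
open import Data.List.Membership.Propositional renaming (_∈_ to _∈ₗ_)
open import Data.Product using (_×_; _,_; Σ; ∃; proj₁; proj₂)
open import Relation.Nullary using (yes; no)
open import Relation.Binary.PropositionalEquality using (_≡_)

-- Cells are 0-indexed: row s ∈ Fin r stands for row (toℕ s + 1) of the paper.
-- A candidate diagram is a Boolean membership function on [r] × [c].
Shape : ℕ → ℕ → Set
Shape r c = Fin r → Fin c → Bool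

cellAt : ∀ {r c} → Shape r c → ℕ → ℕ → Bool
cellAt {r} {c} Y i j with i <? r | j <? c
... | yes i<r | yes j<c = Y (fromℕ< i<r) (fromℕ< j<c)
... | _       | _       = false

IsYoung : ∀ {r c} → Shape r c → Set
IsYoung {r} {c} Y =
  ∀ (s : Fin r) (t : Fin c) → Y s t ≡ true →
    (∀ (i : ℕ) → suc i ≡ toℕ s → cellAt Y i (toℕ t) ≡ true) ×
    (∀ (j : ℕ) → suc j ≡ toℕ t → cellAt Y (toℕ s) j ≡ true)

record Rect (r c : ℕ) : Set where
  constructor _⊠_
  field
    rowsOf : Subset r
    colsOf : Subset c
open Rect public

RectIn : ∀ {r c} → Shape r c → Rect r c → Set
RectIn Y R = ∀ s t → s ∈ rowsOf R → t ∈ colsOf R → Y s t ≡ true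

Covers : ∀ {r c} → Shape r c → List (Rect r c) → Set
Covers Y C =
  (∀ R → R ∈ₗ C → RectIn Y R) ×
  (∀ s t → Y s t ≡ true → ∃ λ R → R ∈ₗ C × s ∈ rowsOf R × t ∈ colsOf R)

rowUsage : ∀ {r c} → List (Rect r c) → Fin r → ℕ
rowUsage C s = length (filterᵇ (λ R → lookup (rowsOf R) s) C)

colUsage : ∀ {r c} → List (Rect r c) → Fin c → ℕ
colUsage C t = length (filterᵇ (λ R → lookup (colsOf R) t) C)

isStep : ∀ {r c} → Shape r c → Fin r → Fin c → Bool
isStep Y s t = Y s t ∧ not (cellAt Y (suc (toℕ s)) (toℕ t))
                     ∧ not (cellAt Y (toℕ s) (suc (toℕ t)))

numSteps : ∀ {r c} → Shape r c → ℕ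
numSteps {r} {c} Y =
  length (filterᵇ (λ st → isStep Y (proj₁ st) (proj₂ st))
    (concatMap (λ s → map (λ t → (s , t)) (allFin c)) (allFin r)))

-- Order the steps of Y by row: they then descend strictly to the left, and a cell (s, t) lies in Y
-- iff fewer steps lie above row s than lie in columns ≥ t.  So sending the row of the i-th step to
-- the point i and the column of the i-th step to the point i + 1 turns Y into the staircase
-- {(v, w) : v < w} on the points 0, …, m, where m is the number of steps, and a cover of Y using
-- every row and column at most k times becomes a cover of this staircase by bicliques L × R
-- (max L < min R) in which every point lies in at most k sets L and at most k sets R.
-- On n points such a cover with bounds a, b exists iff n ≤ (a + b choose a).  For the bound, cut
-- the points at some t such that, keeping in each part only the bicliques that still meet it on both
-- sides, the lower part needs left bound a − 1 and the upper part right bound b − 1; a sweep from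
-- the bottom finds t, and Pascal's rule closes the induction.  The same recursion, with one extra
-- biclique joining the two parts, builds a cover of (a + b choose a) points.
module Submission where

open import Defs
open import Data.Nat using (ℕ; zero; suc; _+_; _*_; _≤_; _<_; _≤′_; ≤′-reflexive; ≤′-step; z≤n; s≤s; s≤s⁻¹; _≤?_; _<?_; NonZero)
open import Data.Nat.Properties
open import Data.Nat.Combinatorics using (_C_; nCk+nC[k+1]≡[n+1]C[k+1]; nCn≡1)
open import Data.Bool using (Bool; true; false; _∧_; T; T?)
open import Data.Bool.Properties using (T-≡) renaming (_≟_ to _≟ᵇ_)
open import Data.Fin using (Fin; toℕ; fromℕ<)
open import Data.Fin.Properties using (toℕ<n; fromℕ<-toℕ; toℕ-fromℕ<)
open import Data.Fin.Subset using () renaming (_∈_ to _∈ˢ_)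
open import Data.Vec using (lookup; tabulate)
open import Data.Vec.Properties using ([]=⇒lookup; lookup⇒[]=; lookup∘tabulate; ≡-dec)
open import Data.List using (List; []; _∷_; length; filterᵇ; _++_; map; concatMap; allFin; deduplicate)
open import Data.List.Properties using (filter-++; length-++)
open import Data.List.Membership.Propositional using (_∈_; find; lose)
open import Data.List.Membership.Propositional.Properties
  using (∈-++⁻; ∈-++⁺ˡ; ∈-++⁺ʳ; ∈-filter⁺; ∈-concatMap⁺; ∈-map⁺; ∈-map⁻; ∈-allFin)
open import Data.List.Relation.Unary.Any using (Any; here; there)
import Data.List.Relation.Unary.Any.Properties as Anyₚ
open import Data.List.Relation.Unary.All as All using (All; []; _∷_)
import Data.List.Relation.Unary.All.Properties as Allₚ
open import Data.List.Relation.Unary.AllPairs as AllPairs using (AllPairs; []; _∷_)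
import Data.List.Relation.Unary.AllPairs.Properties as AllPairsₚ
open import Data.List.Relation.Unary.Unique.Propositional using (Unique)
open import Data.List.Relation.Unary.Unique.DecPropositional.Properties using (deduplicate-!)
open import Data.List.Relation.Binary.Sublist.Propositional using (_⊆_; []; _∷_; ⊆-trans)
open import Data.List.Relation.Binary.Sublist.Propositional.Properties using (filter-⊆; filter⁺)
import Data.List.Relation.Binary.Sublist.Heterogeneous.Properties as Sublistₚ
open import Data.Maybe using (Maybe; just; nothing; maybe′)
open import Data.Product using (_×_; _,_; ∃; proj₁; proj₂)
open import Data.Sum using (_⊎_; inj₁; inj₂)
open import Data.Empty using (⊥; ⊥-elim)
open import Function using (_∘_; _⇔_; mk⇔; Equivalence)
open import Relation.Binary.Definitions using (DecidableEquality)
open import Relation.Nullary using (Dec; yes; no; _×-dec_; contradiction)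
open import Relation.Nullary.Decidable using (isYes; toWitness; fromWitness)
open import Relation.Binary.PropositionalEquality

count : {A : Set} → (A → Bool) → List A → ℕ
count p xs = length (filterᵇ p xs)

module _ {A : Set} where

  count-++ : ∀ (p : A → Bool) xs ys → count p (xs ++ ys) ≡ count p xs + count p ys
  count-++ p xs ys = trans (cong length (filter-++ _ xs ys)) (length-++ (filterᵇ p xs))

  count-[_] : ∀ {p : A → Bool} x → count p (x ∷ []) ≤ 1
  count-[_] {p} x with p x
  ... | true  = ≤-refl
  ... | false = z≤n

  count-≗ : ∀ {p q : A → Bool} → (∀ x → p x ≡ q x) → ∀ xs → count p xs ≡ count q xs
  count-≗ p≗q [] = refl
  count-≗ {p} {q} p≗q (x ∷ xs) rewrite p≗q x with q x
  ... | true  = cong suc (count-≗ p≗q xs)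
  ... | false = count-≗ p≗q xs

  count≡0 : ∀ {p : A → Bool} xs → (∀ {x} → x ∈ xs → p x ≡ true → ⊥) → count p xs ≡ 0
  count≡0 [] _ = refl
  count≡0 {p} (x ∷ xs) none with p x in px
  ... | true  = ⊥-elim (none (here refl) px)
  ... | false = count≡0 xs (none ∘ there)

  count>0⇒∃ : ∀ {p : A → Bool} xs → 0 < count p xs → ∃ λ x → x ∈ xs × p x ≡ true
  count>0⇒∃ {p} (x ∷ xs) pos with p x in px
  ... | true  = x , here refl , px
  ... | false with y , y∈xs , py ← count>0⇒∃ xs pos = y , there y∈xs , py

  ∈⇒count>0 : ∀ {p : A → Bool} {x} xs → x ∈ xs → p x ≡ true → 0 < count p xs
  ∈⇒count>0 (y ∷ xs) (here refl) px rewrite px = s≤s z≤n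
  ∈⇒count>0 {p} (y ∷ xs) (there x∈xs) px with p y
  ... | true  = s≤s z≤n
  ... | false = ∈⇒count>0 xs x∈xs px

  count-∧-≤ : ∀ (p q : A → Bool) xs → count (λ x → p x ∧ q x) xs ≤ count p xs
  count-∧-≤ p q [] = z≤n
  count-∧-≤ p q (x ∷ xs) with p x | q x
  ... | true  | true  = s≤s (count-∧-≤ p q xs)
  ... | true  | false = m≤n⇒m≤1+n (count-∧-≤ p q xs)
  ... | false | _     = count-∧-≤ p q xs

  count-∧-saturated : ∀ (p q : A → Bool) xs → count p xs ≤ count (λ x → p x ∧ q x) xs →
                      ∀ {x} → x ∈ xs → p x ≡ true → q x ≡ true
  count-∧-saturated p q (y ∷ xs) le (here refl) px rewrite px with q y in qy
  ... | true  = refl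
  ... | false = ⊥-elim (<⇒≱ (s≤s (count-∧-≤ p q xs)) le)
  count-∧-saturated p q (y ∷ xs) le (there x∈xs) px with p y | q y
  ... | true  | true  = count-∧-saturated p q xs (s≤s⁻¹ le) x∈xs px
  ... | true  | false = ⊥-elim (<⇒≱ (s≤s (count-∧-≤ p q xs)) le)
  ... | false | _     = count-∧-saturated p q xs le x∈xs px

  count-map : ∀ {B : Set} (p : A → Bool) (f : B → A) xs → count p (map f xs) ≡ count (p ∘ f) xs
  count-map p f [] = refl
  count-map p f (x ∷ xs) with p (f x)
  ... | true  = cong suc (count-map p f xs)
  ... | false = count-map p f xs

  deduplicate-⊆ : (_≟_ : DecidableEquality A) → ∀ xs → deduplicate _≟_ xs ⊆ xs
  deduplicate-⊆ _≟_ [] = []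
  deduplicate-⊆ _≟_ (x ∷ xs) = refl ∷ ⊆-trans (filter-⊆ _ _) (deduplicate-⊆ _≟_ xs)

  count-deduplicate : (_≟_ : DecidableEquality A) → ∀ p xs → count p (deduplicate _≟_ xs) ≤ count p xs
  count-deduplicate _≟_ p xs =
    Sublistₚ.length-mono-≤ (filter⁺ _ _ (λ { refl → λ z → z }) (deduplicate-⊆ _≟_ xs))

-- Covers of the staircase by bicliques

-- Opaque, so that f, lo and hi can be inferred from someIn f lo hi (isYes is not injective).
opaque
  someIn? : ∀ (f : ℕ → Bool) lo hi → Dec (∃ λ w → w < hi × lo ≤ w × f w ≡ true)
  someIn? f lo hi = anyUpTo? (λ w → lo ≤? w ×-dec f w ≟ᵇ true) hi

  someIn : (ℕ → Bool) → ℕ → ℕ → Bool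
  someIn f lo hi = isYes (someIn? f lo hi)

  someIn-sound : ∀ {f lo hi} → someIn f lo hi ≡ true → ∃ λ w → w < hi × lo ≤ w × f w ≡ true
  someIn-sound {f} {lo} {hi} = toWitness {a? = someIn? f lo hi} ∘ Equivalence.from T-≡

  someIn-complete : ∀ {f lo hi w} → lo ≤ w → w < hi → f w ≡ true → someIn f lo hi ≡ true
  someIn-complete {f} {lo} {hi} {w} lo≤w w<hi fw =
    Equivalence.to T-≡ (fromWitness {a? = someIn? f lo hi} (w , w<hi , lo≤w , fw))

∧-true⁻ : ∀ {x y} → x ∧ y ≡ true → x ≡ true × y ≡ true
∧-true⁻ {true} y≡true = refl , y≡true

∧-true⁺ : ∀ {x y} → x ≡ true → y ≡ true → x ∧ y ≡ true
∧-true⁺ refl refl = refl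

record StaircaseCover {E : Set} (Cov : List E) (left right : ℕ → E → Bool) (lo hi a b : ℕ) : Set where
  field
    left<right : ∀ {x v w} → x ∈ Cov → left v x ≡ true → right w x ≡ true → v < w
    cover      : ∀ {v w} → lo ≤ v → v < w → w < hi →
                 ∃ λ x → x ∈ Cov × left v x ≡ true × right w x ≡ true
    left-load  : ∀ {v} → lo ≤ v → v < hi → count (left v) Cov ≤ a
    right-load : ∀ {w} → lo ≤ w → w < hi → count (right w) Cov ≤ b

module Split {E : Set} {Cov : List E} {left right : ℕ → E → Bool} {lo hi a b : ℕ}
             (S : StaircaseCover Cov left right lo hi (suc a) (suc b)) where
  open StaircaseCover S

  leftBelow : ℕ → ℕ → E → Bool
  leftBelow t v x = left v x ∧ someIn (λ w → right w x) lo t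

  rightAbove : ℕ → ℕ → E → Bool
  rightAbove t w x = right w x ∧ someIn (λ v → left v x) t hi

  LeftBalanced : ℕ → Set
  LeftBalanced t = ∀ {v} → lo ≤ v → v < t → count (leftBelow t v) Cov ≤ a

  RightBalanced : ℕ → Set
  RightBalanced t = ∀ {w} → t ≤ w → w < hi → count (rightAbove t w) Cov ≤ b

  lower : ∀ {t} → t < hi → LeftBalanced t → StaircaseCover Cov (leftBelow t) right lo t a (suc b)
  lower t<hi balanced = record
    { left<right = λ x∈ lx rx → left<right x∈ (proj₁ (∧-true⁻ lx)) rx
    ; cover      = λ {v} {w} lo≤v v<w w<t →
        let x , x∈ , lx , rx = cover lo≤v v<w (<-trans w<t t<hi)
        in  x , x∈ , ∧-true⁺ lx (someIn-complete (≤-trans lo≤v (<⇒≤ v<w)) w<t rx) , rx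
    ; left-load  = balanced
    ; right-load = λ lo≤w w<t → right-load lo≤w (<-trans w<t t<hi)
    }

  upper : ∀ {t} → lo < t → RightBalanced t → StaircaseCover Cov left (rightAbove t) t hi (suc a) b
  upper lo<t balanced = record
    { left<right = λ x∈ lx rx → left<right x∈ lx (proj₁ (∧-true⁻ rx))
    ; cover      = λ {v} {w} t≤v v<w w<hi →
        let x , x∈ , lx , rx = cover (≤-trans (<⇒≤ lo<t) t≤v) v<w w<hi
        in  x , x∈ , lx , ∧-true⁺ rx (someIn-complete t≤v (<-trans v<w w<hi) lx)
    ; left-load  = λ t≤v v<hi → left-load (≤-trans (<⇒≤ lo<t) t≤v) v<hi
    ; right-load = balanced
    }

  no-crossing : ∀ {t x} → x ∈ Cov → someIn (λ v → left v x) t hi ≡ true →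
                someIn (λ w → right w x) lo (suc t) ≡ true → ⊥
  no-crossing x∈ reachesLeft reachesRight
    with v , _ , t≤v , lv ← someIn-sound reachesLeft
       | w , w<1+t , _ , rw ← someIn-sound reachesRight
    = <⇒≱ (left<right x∈ lv rw) (≤-trans (s≤s⁻¹ w<1+t) t≤v)

  leftBalanced-start : LeftBalanced (suc lo)
  leftBalanced-start {v} lo≤v v<1+lo = subst (_≤ a) (sym (count≡0 Cov empty)) z≤n
    where
    empty : ∀ {x} → x ∈ Cov → leftBelow (suc lo) v x ≡ true → ⊥
    empty x∈ lbx with lx , reaches ← ∧-true⁻ lbx
                 with w , w<1+lo , _ , rw ← someIn-sound reaches
      = <⇒≱ (left<right x∈ lx rw) (≤-trans (s≤s⁻¹ w<1+lo) lo≤v)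

  -- An overloaded w in the upper part forces every biclique at w to have a left vertex ≥ t;
  -- an overloaded v ≤ t in the lower part would force a biclique covering (v, w) to cross t.
  overloaded-step : ∀ {t w} → lo ≤ t → t ≤ w → w < hi → b < count (rightAbove t w) Cov →
                    t < w × LeftBalanced (suc t)
  overloaded-step {t} {w} lo≤t t≤w w<hi over = t<w , leftBalanced
    where
    lo≤w = ≤-trans lo≤t t≤w

    saturated : ∀ {x} → x ∈ Cov → right w x ≡ true → someIn (λ v → left v x) t hi ≡ true
    saturated = count-∧-saturated (right w) _ Cov (≤-trans (right-load lo≤w w<hi) over)

    t<w : t < w
    t<w with x , x∈ , rax ← count>0⇒∃ Cov (≤-<-trans z≤n over)
        with rx , reaches ← ∧-true⁻ rax
        with v , _ , t≤v , lv ← someIn-sound reaches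
      = ≤-<-trans t≤v (left<right x∈ lv rx)

    leftBalanced : LeftBalanced (suc t)
    leftBalanced {v} lo≤v v<1+t with count (leftBelow (suc t) v) Cov ≤? a
    ... | yes fine = fine
    ... | no over′ with x , x∈ , lx , rx ← cover lo≤v (≤-<-trans (s≤s⁻¹ v<1+t) t<w) w<hi
      = ⊥-elim (no-crossing x∈ (saturated x∈ rx)
          (count-∧-saturated (left v) _ Cov (≤-trans (left-load lo≤v (<-trans v<1+t (≤-<-trans t<w w<hi))) (≰⇒> over′)) x∈ lx))

  balanced-split : suc lo < hi → ∃ λ t → lo < t × t < hi × LeftBalanced t × RightBalanced t
  balanced-split 1+lo<hi = search hi (suc lo) (m≤n+m hi (suc lo)) ≤-refl 1+lo<hi leftBalanced-start
    where
    search : ∀ d t → hi ≤ t + d → lo < t → t < hi → LeftBalanced t →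
             ∃ λ t → lo < t × t < hi × LeftBalanced t × RightBalanced t
    search zero t hi≤t _ t<hi _ = ⊥-elim (<⇒≱ t<hi (subst (hi ≤_) (+-identityʳ t) hi≤t))
    search (suc d) t hi≤t+d lo<t t<hi lb
      with anyUpTo? (λ w → t ≤? w ×-dec b <? count (rightAbove t w) Cov) hi
    ... | no none = t , lo<t , t<hi , lb , λ t≤w w<hi → ≮⇒≥ λ over → none (_ , w<hi , t≤w , over)
    ... | yes (w , w<hi , t≤w , over) with t<w , lb′ ← overloaded-step (<⇒≤ lo<t) t≤w w<hi over
      = search d (suc t) (subst (hi ≤_) (+-suc t d) hi≤t+d) (m<n⇒m<1+n lo<t) (≤-<-trans t<w w<hi) lb′

pascal : ∀ a b → (a + suc b) C a + (suc a + b) C suc a ≡ (suc a + suc b) C suc a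
pascal a b = trans (cong (λ n → (a + suc b) C a + n C suc a) (sym (+-suc a b)))
                   (nCk+nC[k+1]≡[n+1]C[k+1] (a + suc b) a)

1≤C : ∀ a b → 1 ≤ (a + b) C a
1≤C a zero rewrite +-identityʳ a | nCn≡1 a = ≤-refl
1≤C zero (suc b) = ≤-refl
1≤C (suc a) (suc b) = ≤-trans (1≤C a (suc b)) (subst ((a + suc b) C a ≤_) (pascal a b) (m≤m+n _ _))

staircaseCover-bound : ∀ {E} {Cov : List E} {left right} a b {lo hi} →
                       StaircaseCover Cov left right lo hi a b → hi ≤ lo + (a + b) C a
staircaseCover-bound a b {lo} {hi} S with hi ≤? suc lo
... | yes hi≤1+lo = ≤-trans hi≤1+lo (subst (_≤ lo + (a + b) C a) (+-comm lo 1) (+-monoʳ-≤ lo (1≤C a b)))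
... | no hi≰1+lo = split a b S (≰⇒> hi≰1+lo)
  where
  split : ∀ a b → StaircaseCover _ _ _ lo hi a b → suc lo < hi → hi ≤ lo + (a + b) C a
  split zero b S 1+lo<hi with _ , x∈ , lx , _ ← StaircaseCover.cover S ≤-refl ≤-refl 1+lo<hi
    = ⊥-elim (<⇒≱ (∈⇒count>0 _ x∈ lx) (StaircaseCover.left-load S ≤-refl (<-trans ≤-refl 1+lo<hi)))
  split (suc a) zero S 1+lo<hi with _ , x∈ , _ , rx ← StaircaseCover.cover S ≤-refl ≤-refl 1+lo<hi
    = ⊥-elim (<⇒≱ (∈⇒count>0 _ x∈ rx) (StaircaseCover.right-load S (n≤1+n lo) 1+lo<hi))
  split (suc a) (suc b) S 1+lo<hi
    with t , lo<t , t<hi , lb , rb ← Split.balanced-split S 1+lo<hi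
    = begin
      hi                                                 ≤⟨ staircaseCover-bound (suc a) b (Split.upper S lo<t rb) ⟩
      t + (suc a + b) C suc a                            ≤⟨ +-monoˡ-≤ _ (staircaseCover-bound a (suc b) (Split.lower S t<hi lb)) ⟩
      lo + (a + suc b) C a + (suc a + b) C suc a         ≡⟨ +-assoc lo _ _ ⟩
      lo + ((a + suc b) C a + (suc a + b) C suc a)       ≡⟨ cong (lo +_) (pascal a b) ⟩
      lo + (suc a + suc b) C suc a                       ∎
    where open ≤-Reasoning

-- The optimal covers

opaque
  inInterval : ℕ → ℕ → ℕ → Bool
  inInterval lo hi v = isYes (lo ≤? v ×-dec v <? hi)

  inInterval-sound : ∀ {lo hi v} → inInterval lo hi v ≡ true → lo ≤ v × v < hi
  inInterval-sound {lo} {hi} {v} = toWitness {a? = lo ≤? v ×-dec v <? hi} ∘ Equivalence.from T-≡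

  inInterval-complete : ∀ {lo hi v} → lo ≤ v → v < hi → inInterval lo hi v ≡ true
  inInterval-complete {lo} {hi} {v} lo≤v v<hi =
    Equivalence.to T-≡ (fromWitness {a? = lo ≤? v ×-dec v <? hi} (lo≤v , v<hi))

C-zeroʳ : ∀ a → (a + 0) C a ≡ 1
C-zeroʳ a = trans (cong (_C a) (+-identityʳ a)) (nCn≡1 a)

record Block : Set where
  constructor block
  field
    start middle end : ℕ

blockLeft : ℕ → Block → Bool
blockLeft v (block s m e) = inInterval s m v

blockRight : ℕ → Block → Bool
blockRight w (block s m e) = inInterval m e w

blockLeft<blockRight : ∀ {x v w} → blockLeft v x ≡ true → blockRight w x ≡ true → v < w
blockLeft<blockRight lx rx = <-≤-trans (proj₂ (inInterval-sound lx)) (proj₁ (inInterval-sound rx))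

pivot : ℕ → ℕ → ℕ → ℕ
pivot a b lo = lo + (a + suc b) C a

pivot+C : ∀ a b lo → pivot a b lo + (suc a + b) C suc a ≡ lo + (suc a + suc b) C suc a
pivot+C a b lo = trans (+-assoc lo _ _) (cong (lo +_) (pascal a b))

crossBlock : ℕ → ℕ → ℕ → Block
crossBlock a b lo = block lo (pivot a b lo) (lo + (suc a + suc b) C suc a)

-- Pascal's rule splits [lo, lo + (a+1 + b+1) C (a+1)) at the pivot; each part is covered
-- recursively, and all pairs across the pivot by one further block.
blocks : ℕ → ℕ → ℕ → List Block
blocks zero    b       lo = []
blocks (suc a) zero    lo = []
blocks (suc a) (suc b) lo =
  blocks a (suc b) lo ++ blocks (suc a) b (pivot a b lo) ++ crossBlock a b lo ∷ []

Within : ℕ → ℕ → Block → Set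
Within lo hi x = ∀ v → blockLeft v x ≡ true ⊎ blockRight v x ≡ true → lo ≤ v × v < hi

within-mono : ∀ {lo lo′ hi′ hi x} → lo ≤ lo′ → hi′ ≤ hi → Within lo′ hi′ x → Within lo hi x
within-mono lo≤lo′ hi′≤hi within v side with lo′≤v , v<hi′ ← within v side =
  ≤-trans lo≤lo′ lo′≤v , <-≤-trans v<hi′ hi′≤hi

blocks-within : ∀ a b lo {x} → x ∈ blocks a b lo → Within lo (lo + (a + b) C a) x
blocks-within (suc a) (suc b) lo x∈ with ∈-++⁻ (blocks a (suc b) lo) x∈
... | inj₁ x∈lower = within-mono ≤-refl (≤-trans (m≤m+n _ _) (≤-reflexive (pivot+C a b lo)))
                       (blocks-within a (suc b) lo x∈lower)
... | inj₂ x∈rest with ∈-++⁻ (blocks (suc a) b (pivot a b lo)) x∈rest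
...   | inj₁ x∈upper = within-mono (m≤m+n lo _) (≤-reflexive (pivot+C a b lo))
                         (blocks-within (suc a) b (pivot a b lo) x∈upper)
...   | inj₂ (here refl) = λ where
  v (inj₁ lx) → let lo≤v , v<pivot = inInterval-sound lx
              in lo≤v , <-≤-trans v<pivot (≤-trans (m≤m+n _ _) (≤-reflexive (pivot+C a b lo)))
  v (inj₂ rx) → let pivot≤v , v<top = inInterval-sound rx
              in ≤-trans (m≤m+n lo _) pivot≤v , v<top

count-blocks : ∀ p a b lo → count p (blocks (suc a) (suc b) lo) ≡
  count p (blocks a (suc b) lo) + (count p (blocks (suc a) b (pivot a b lo)) + count p (crossBlock a b lo ∷ []))
count-blocks p a b lo =
  trans (count-++ p (blocks a (suc b) lo) _) (cong (count p (blocks a (suc b) lo) +_) (count-++ p (blocks (suc a) b _) _))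

blocks-cover : ∀ a b lo {v w} → lo ≤ v → v < w → w < lo + (a + b) C a →
               ∃ λ x → x ∈ blocks a b lo × blockLeft v x ≡ true × blockRight w x ≡ true
blocks-cover zero b lo {w = w} lo≤v v<w w<1+lo =
  ⊥-elim (<⇒≱ (≤-<-trans lo≤v v<w) (s≤s⁻¹ (subst (w <_) (+-comm lo 1) w<1+lo)))
blocks-cover (suc a) zero lo {w = w} lo≤v v<w w<top =
  ⊥-elim (<⇒≱ (≤-<-trans lo≤v v<w) (s≤s⁻¹ (subst (w <_) (trans (cong (lo +_) (C-zeroʳ (suc a))) (+-comm lo 1)) w<top)))
blocks-cover (suc a) (suc b) lo {v} {w} lo≤v v<w w<top with w <? pivot a b lo | v <? pivot a b lo
... | yes w<pivot | _ with x , x∈ , lx , rx ← blocks-cover a (suc b) lo lo≤v v<w w<pivot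
  = x , ∈-++⁺ˡ x∈ , lx , rx
... | no w≮pivot | no v≮pivot
  with x , x∈ , lx , rx ← blocks-cover (suc a) b (pivot a b lo) (≮⇒≥ v≮pivot) v<w
                                        (subst (w <_) (sym (pivot+C a b lo)) w<top)
  = x , ∈-++⁺ʳ (blocks a (suc b) lo) (∈-++⁺ˡ x∈) , lx , rx
... | no w≮pivot | yes v<pivot =
  crossBlock a b lo , ∈-++⁺ʳ (blocks a (suc b) lo) (∈-++⁺ʳ (blocks (suc a) b _) (here refl)) ,
  inInterval-complete lo≤v v<pivot , inInterval-complete (≮⇒≥ w≮pivot) w<top

blocks-left-load : ∀ a b lo v → count (blockLeft v) (blocks a b lo) ≤ a
blocks-left-load zero    b       lo v = z≤n
blocks-left-load (suc a) zero    lo v = z≤n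
blocks-left-load (suc a) (suc b) lo v =
  subst (_≤ suc a) (sym (count-blocks (blockLeft v) a b lo)) (by-position (v <? pivot a b lo))
  where
  lower = blocks a (suc b) lo
  upper = blocks (suc a) b (pivot a b lo)
  cross = crossBlock a b lo ∷ []

  by-position : Dec (v < pivot a b lo) →
                count (blockLeft v) lower + (count (blockLeft v) upper + count (blockLeft v) cross) ≤ suc a
  by-position (yes v<pivot) = begin
    count (blockLeft v) lower + (count (blockLeft v) upper + count (blockLeft v) cross)
      ≡⟨ cong (λ n → count (blockLeft v) lower + (n + count (blockLeft v) cross)) (count≡0 upper
           λ x∈ lx → <⇒≱ v<pivot (proj₁ (blocks-within (suc a) b _ x∈ v (inj₁ lx)))) ⟩
    count (blockLeft v) lower + count (blockLeft v) cross
      ≤⟨ +-mono-≤ (blocks-left-load a (suc b) lo v) (count-[_] {p = blockLeft v} (crossBlock a b lo)) ⟩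
    a + 1
      ≡⟨ +-comm a 1 ⟩
    suc a ∎
    where open ≤-Reasoning
  by-position (no v≮pivot) = begin
    count (blockLeft v) lower + (count (blockLeft v) upper + count (blockLeft v) cross)
      ≡⟨ cong₂ (λ m n → m + (count (blockLeft v) upper + n))
           (count≡0 lower λ x∈ lx → v≮pivot (proj₂ (blocks-within a (suc b) lo x∈ v (inj₁ lx))))
           (count≡0 {p = blockLeft v} cross λ { (here refl) lx → v≮pivot (proj₂ (inInterval-sound lx)) }) ⟩
    count (blockLeft v) upper + 0
      ≡⟨ +-identityʳ _ ⟩
    count (blockLeft v) upper
      ≤⟨ blocks-left-load (suc a) b (pivot a b lo) v ⟩
    suc a ∎
    where open ≤-Reasoning

blocks-right-load : ∀ a b lo w → count (blockRight w) (blocks a b lo) ≤ b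
blocks-right-load zero    b       lo w = z≤n
blocks-right-load (suc a) zero    lo w = z≤n
blocks-right-load (suc a) (suc b) lo w =
  subst (_≤ suc b) (sym (count-blocks (blockRight w) a b lo)) (by-position (w <? pivot a b lo))
  where
  lower = blocks a (suc b) lo
  upper = blocks (suc a) b (pivot a b lo)
  cross = crossBlock a b lo ∷ []

  by-position : Dec (w < pivot a b lo) →
                count (blockRight w) lower + (count (blockRight w) upper + count (blockRight w) cross) ≤ suc b
  by-position (yes w<pivot) = begin
    count (blockRight w) lower + (count (blockRight w) upper + count (blockRight w) cross)
      ≡⟨ cong₂ (λ m n → count (blockRight w) lower + (m + n))
           (count≡0 upper λ x∈ rx → <⇒≱ w<pivot (proj₁ (blocks-within (suc a) b _ x∈ w (inj₂ rx))))
           (count≡0 {p = blockRight w} cross λ { (here refl) rx → <⇒≱ w<pivot (proj₁ (inInterval-sound rx)) }) ⟩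
    count (blockRight w) lower + 0
      ≡⟨ +-identityʳ _ ⟩
    count (blockRight w) lower
      ≤⟨ blocks-right-load a (suc b) lo w ⟩
    suc b ∎
    where open ≤-Reasoning
  by-position (no w≮pivot) = begin
    count (blockRight w) lower + (count (blockRight w) upper + count (blockRight w) cross)
      ≡⟨ cong (_+ (count (blockRight w) upper + count (blockRight w) cross))
           (count≡0 lower λ x∈ rx → w≮pivot (proj₂ (blocks-within a (suc b) lo x∈ w (inj₂ rx)))) ⟩
    count (blockRight w) upper + count (blockRight w) cross
      ≤⟨ +-mono-≤ (blocks-right-load (suc a) b (pivot a b lo) w) (count-[_] {p = blockRight w} (crossBlock a b lo)) ⟩
    b + 1
      ≡⟨ +-comm b 1 ⟩
    suc b ∎
    where open ≤-Reasoning

blocks-staircaseCover : ∀ a b lo → StaircaseCover (blocks a b lo) blockLeft blockRight lo (lo + (a + b) C a) a b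
blocks-staircaseCover a b lo = record
  { left<right = λ _ → blockLeft<blockRight
  ; cover      = blocks-cover a b lo
  ; left-load  = λ _ _ → blocks-left-load a b lo _
  ; right-load = λ _ _ → blocks-right-load a b lo _
  }

-- The steps of a Young diagram

nth : {A : Set} → List A → ℕ → Maybe A
nth []       _       = nothing
nth (x ∷ xs) zero    = just x
nth (x ∷ xs) (suc v) = nth xs v

module _ {A : Set} where

  nth⇒∈ : ∀ xs v {x : A} → nth xs v ≡ just x → x ∈ xs
  nth⇒∈ (y ∷ xs) zero    refl = here refl
  nth⇒∈ (y ∷ xs) (suc v) eq   = there (nth⇒∈ xs v eq)

  nth-just : ∀ (xs : List A) {v} → v < length xs → ∃ λ x → nth xs v ≡ just x
  nth-just (y ∷ xs) {zero}  _   = y , refl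
  nth-just (y ∷ xs) {suc v} v<n = nth-just xs (s≤s⁻¹ v<n)

module Ranks {P : Set} (row col : P → ℕ) where

  Descending : P → P → Set
  Descending x y = row x < row y × col y < col x

  Dominates : ℕ → ℕ → P → Set
  Dominates s t x = s ≤ row x × t ≤ col x

  rowRank : ℕ → List P → ℕ
  rowRank s [] = 0
  rowRank s (x ∷ xs) with s ≤? row x
  ... | yes _ = 0
  ... | no  _ = suc (rowRank s xs)

  colRank : ℕ → List P → ℕ
  colRank t [] = 0
  colRank t (x ∷ xs) with t ≤? col x
  ... | yes _ = suc (colRank t xs)
  ... | no  _ = 0

  colRank≤length : ∀ t xs → colRank t xs ≤ length xs
  colRank≤length t [] = z≤n
  colRank≤length t (x ∷ xs) with t ≤? col x
  ... | yes _ = s≤s (colRank≤length t xs)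
  ... | no  _ = z≤n

  rank<⇒dominated : ∀ {s t} xs → rowRank s xs < colRank t xs → Any (Dominates s t) xs
  rank<⇒dominated {s} {t} (x ∷ xs) lt with t ≤? col x | s ≤? row x
  ... | no  _   | _     = contradiction lt λ ()
  ... | yes t≤x | yes s≤x = here (s≤x , t≤x)
  ... | yes t≤x | no  _   = there (rank<⇒dominated xs (s≤s⁻¹ lt))

  dominated⇒rank< : ∀ {s t xs} → AllPairs Descending xs → Any (Dominates s t) xs → rowRank s xs < colRank t xs
  dominated⇒rank< {s} {t} {x ∷ xs} (x↓ ∷ desc) dom with s ≤? row x | t ≤? col x
  ... | yes _ | yes _ = s≤s z≤n
  ... | no s≰x | yes _ with dom
  ...   | here (s≤x , _) = contradiction s≤x s≰x
  ...   | there d        = s≤s (dominated⇒rank< desc d)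
  dominated⇒rank< {s} {t} {x ∷ xs} (x↓ ∷ desc) dom | _ | no t≰x with dom
  ...   | here (_ , t≤x) = contradiction t≤x t≰x
  ...   | there d with z , z∈ , _ , t≤z ← find d
    = contradiction (≤-trans t≤z (<⇒≤ (proj₂ (All.lookup x↓ z∈)))) t≰x

  rowRank-nth : ∀ {xs} → AllPairs Descending xs → ∀ v {x} → nth xs v ≡ just x → rowRank (row x) xs ≡ v
  rowRank-nth {y ∷ xs} (y↓ ∷ desc) zero refl with row y ≤? row y
  ... | yes _   = refl
  ... | no  y≰y = contradiction ≤-refl y≰y
  rowRank-nth {y ∷ xs} (y↓ ∷ desc) (suc v) {x} eq with row x ≤? row y
  ... | yes x≤y = contradiction (proj₁ (All.lookup y↓ (nth⇒∈ xs v eq))) (≤⇒≯ x≤y)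
  ... | no  _   = cong suc (rowRank-nth desc v eq)

  colRank-nth : ∀ {xs} → AllPairs Descending xs → ∀ w {x} → nth xs w ≡ just x → colRank (col x) xs ≡ suc w
  colRank-nth {y ∷ xs} (y↓ ∷ desc) zero refl with col y ≤? col y
  ... | no  y≰y = contradiction ≤-refl y≰y
  ... | yes _   = cong suc (nothing-after xs y↓)
    where
    nothing-after : ∀ zs → All (Descending y) zs → colRank (col y) zs ≡ 0
    nothing-after []       []         = refl
    nothing-after (z ∷ zs) (z↓ ∷ _) with col y ≤? col z
    ... | yes y≤z = contradiction (proj₂ z↓) (≤⇒≯ y≤z)
    ... | no  _   = refl
  colRank-nth {y ∷ xs} (y↓ ∷ desc) (suc w) {x} eq with col x ≤? col y
  ... | yes _   = cong suc (colRank-nth desc w eq)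
  ... | no  x≰y = contradiction (<⇒≤ (proj₂ (All.lookup y↓ (nth⇒∈ xs w eq)))) x≰y

last-true : (f : ℕ → Bool) → ∀ {n} d → f n ≡ true → f (n + d) ≡ false →
            ∃ λ m → n ≤ m × f m ≡ true × f (suc m) ≡ false
last-true f {n} zero fn fn+0 with () ← trans (sym fn) (subst (λ k → f k ≡ false) (+-identityʳ n) fn+0)
last-true f {n} (suc d) fn fend with f (suc n) in f1+n
... | false = n , ≤-refl , fn , f1+n
... | true with m , 1+n≤m , fm , f1+m ← last-true f d f1+n (subst (λ k → f k ≡ false) (+-suc n d) fend)
  = m , <⇒≤ 1+n≤m , fm , f1+m

allPairs-discharge : ∀ {A : Set} {P : A → Set} {R : A → A → Set} {xs} →
                     All P xs → AllPairs (λ x y → P x → P y → R x y) xs → AllPairs R xs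
allPairs-discharge []         []         = []
allPairs-discharge (px ∷ pxs) (rx ∷ rxs) =
  All.zipWith (λ (py , f) → f px py) (pxs , rx) ∷ allPairs-discharge pxs rxs

module YoungDiagram {r c : ℕ} (Y : Shape r c) (young : IsYoung Y) where

  cell : ℕ → ℕ → Bool
  cell = cellAt Y

  cell-fromℕ< : ∀ {i j} (p : i < r) (q : j < c) → cell i j ≡ Y (fromℕ< p) (fromℕ< q)
  cell-fromℕ< {i} {j} p q with i <? r | j <? c
  ... | yes _ | yes _ = refl
  ... | no i≮r | _     = contradiction p i≮r
  ... | yes _ | no j≮c = contradiction q j≮c

  cell-toℕ : ∀ s t → cell (toℕ s) (toℕ t) ≡ Y s t
  cell-toℕ s t = trans (cell-fromℕ< (toℕ<n s) (toℕ<n t)) (cong₂ Y (fromℕ<-toℕ s _) (fromℕ<-toℕ t _))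

  cell-bounded : ∀ {i j} → cell i j ≡ true → i < r × j < c
  cell-bounded {i} {j} e with i <? r | j <? c
  ... | yes i<r | yes j<c = i<r , j<c

  cell-up : ∀ {i j} → cell (suc i) j ≡ true → cell i j ≡ true
  cell-up {i} {j} e with 1+i<r , j<c ← cell-bounded e =
    subst (λ k → cell i k ≡ true) (toℕ-fromℕ< j<c)
      (proj₁ (young _ _ (trans (sym (cell-fromℕ< 1+i<r j<c)) e)) i (sym (toℕ-fromℕ< 1+i<r)))

  cell-left : ∀ {i j} → cell i (suc j) ≡ true → cell i j ≡ true
  cell-left {i} {j} e with i<r , 1+j<c ← cell-bounded e =
    subst (λ k → cell k j ≡ true) (toℕ-fromℕ< i<r)
      (proj₂ (young _ _ (trans (sym (cell-fromℕ< i<r 1+j<c)) e)) j (sym (toℕ-fromℕ< 1+j<c)))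

  cell-mono : ∀ {i j i′ j′} → i′ ≤ i → j′ ≤ j → cell i j ≡ true → cell i′ j′ ≡ true
  cell-mono i′≤i j′≤j = up (≤⇒≤′ i′≤i) ∘ left (≤⇒≤′ j′≤j)
    where
    up : ∀ {i i′ j} → i′ ≤′ i → cell i j ≡ true → cell i′ j ≡ true
    up (≤′-reflexive refl) = λ e → e
    up (≤′-step i′≤i)      = up i′≤i ∘ cell-up
    left : ∀ {i j j′} → j′ ≤′ j → cell i j ≡ true → cell i j′ ≡ true
    left (≤′-reflexive refl) = λ e → e
    left (≤′-step j′≤j)      = left j′≤j ∘ cell-left

  Cell : Set
  Cell = Fin r × Fin c

  row col : Cell → ℕ
  row = toℕ ∘ proj₁
  col = toℕ ∘ proj₂

  open Ranks row col public

  grid : List Cell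
  grid = concatMap (λ s → map (λ t → (s , t)) (allFin c)) (allFin r)

  ∈-grid : ∀ x → x ∈ grid
  ∈-grid (s , t) = ∈-concatMap⁺ (λ s → map (λ t → (s , t)) (allFin c)) (lose (∈-allFin s) (∈-map⁺ (λ t → (s , t)) (∈-allFin t)))

  Lex : Cell → Cell → Set
  Lex x y = row x < row y ⊎ (row x ≡ row y × col x < col y)

  grid-lex : AllPairs Lex grid
  grid-lex = AllPairsₚ.concat⁺
    (Allₚ.map⁺ (Allₚ.tabulate⁺ λ s → AllPairsₚ.map⁺ (AllPairsₚ.tabulate⁺-< λ t<t′ → inj₂ (refl , t<t′))))
    (AllPairsₚ.map⁺ (AllPairsₚ.tabulate⁺-< λ s<s′ →
      Allₚ.map⁺ (Allₚ.tabulate⁺ λ t → Allₚ.map⁺ (Allₚ.tabulate⁺ λ t′ → inj₁ s<s′))))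

  isStepAt : Cell → Bool
  isStepAt x = isStep Y (proj₁ x) (proj₂ x)

  steps : List Cell
  steps = filterᵇ isStepAt grid

  IsCorner : ℕ → ℕ → Set
  IsCorner i j = cell i j ≡ true × cell (suc i) j ≡ false × cell i (suc j) ≡ false

  isStep⇒corner : ∀ x → T (isStepAt x) → IsCorner (row x) (col x)
  isStep⇒corner (s , t) _ with Y s t in inY | cell (suc (toℕ s)) (toℕ t) | cell (toℕ s) (suc (toℕ t))
  ... | true | false | false = trans (cell-toℕ s t) inY , refl , refl

  corner⇒isStep : ∀ s t → IsCorner (toℕ s) (toℕ t) → isStepAt (s , t) ≡ true
  corner⇒isStep s t (inY , down , right)
    rewrite trans (sym (cell-toℕ s t)) inY | down | right = refl

  steps-corners : All (λ x → IsCorner (row x) (col x)) steps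
  steps-corners = All.map (λ {x} → isStep⇒corner x) (Allₚ.all-filter (T? ∘ isStepAt) grid)

  corners-lex⇒descending : ∀ {x y} → Lex x y → IsCorner (row x) (col x) → IsCorner (row y) (col y) → Descending x y
  corners-lex⇒descending (inj₁ x<y) (_ , x-down , _) (y-cell , _ , _) = x<y , ≰⇒> λ x≤y →
    contradiction (trans (sym (cell-mono x<y x≤y y-cell)) x-down) λ ()
  corners-lex⇒descending (inj₂ (x≡y , x<y)) (_ , _ , x-right) (y-cell , _ , _) =
    contradiction (trans (sym (cell-mono (≤-reflexive x≡y) x<y y-cell)) x-right) λ ()

  steps-descending : AllPairs Descending steps
  steps-descending = allPairs-discharge steps-corners
    (AllPairsₚ.filter⁺ (T? ∘ isStepAt) (AllPairs.map corners-lex⇒descending grid-lex))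

  cell≡false-mono : ∀ {i j i′ j′} → i ≤ i′ → j ≤ j′ → cell i j ≡ false → cell i′ j′ ≡ false
  cell≡false-mono {i′ = i′} {j′} i≤i′ j≤j′ out with cell i′ j′ in e
  ... | false = refl
  ... | true  = contradiction (trans (sym (cell-mono i≤i′ j≤j′ e)) out) λ ()

  cell-outside : ∀ {i j} → r ≤ i ⊎ c ≤ j → cell i j ≡ false
  cell-outside {i} {j} out with cell i j in e
  ... | false = refl
  ... | true with i<r , j<c ← cell-bounded e with out
  ...   | inj₁ r≤i = contradiction i<r (≤⇒≯ r≤i)
  ...   | inj₂ c≤j = contradiction j<c (≤⇒≯ c≤j)

  corner⇒step : ∀ {i j} → IsCorner i j → ∃ λ x → x ∈ steps × row x ≡ i × col x ≡ j
  corner⇒step {i} {j} corner@(inY , _ , _) with i<r , j<c ← cell-bounded inY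
    = x , ∈-filter⁺ (T? ∘ isStepAt) (∈-grid x) isStep′ , toℕ-fromℕ< i<r , toℕ-fromℕ< j<c
    where
    x = fromℕ< i<r , fromℕ< j<c
    isStep′ : T (isStepAt x)
    isStep′ = Equivalence.from T-≡ (corner⇒isStep (proj₁ x) (proj₂ x)
                (subst₂ IsCorner (sym (toℕ-fromℕ< i<r)) (sym (toℕ-fromℕ< j<c)) corner))

  -- walking right and then down from a cell ends in a corner of the diagram
  cell⇒dominated : ∀ {s t} → cell s t ≡ true → Any (Dominates s t) steps
  cell⇒dominated {s} {t} inY
    with t′ , t≤t′ , inY′ , right-out ← last-true (cell s) c inY (cell-outside (inj₂ (m≤n+m c t)))
    with s′ , s≤s′ , inY″ , down-out ← last-true (λ i → cell i t′) r inY′ (cell-outside (inj₁ (m≤n+m r s)))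
    with x , x∈ , refl , refl ← corner⇒step (inY″ , down-out , cell≡false-mono s≤s′ ≤-refl right-out)
    = lose x∈ (s≤s′ , t≤t′)

  dominated⇒cell : ∀ {s t} → Any (Dominates s t) steps → cell s t ≡ true
  dominated⇒cell dom with x , x∈ , s≤x , t≤x ← find dom = cell-mono s≤x t≤x (proj₁ (All.lookup steps-corners x∈))

  cell⇒rank< : ∀ {s t} → cell s t ≡ true → rowRank s steps < colRank t steps
  cell⇒rank< = dominated⇒rank< steps-descending ∘ cell⇒dominated

  rank<⇒cell : ∀ {s t} → rowRank s steps < colRank t steps → cell s t ≡ true
  rank<⇒cell = dominated⇒cell ∘ rank<⇒dominated steps

-- Rectangle covers of Y and staircase covers

module CoverToStaircase {r c : ℕ} (Y : Shape r c) (young : IsYoung Y) where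
  open YoungDiagram Y young

  atStep : ℕ → (Cell → Bool) → Bool
  atStep v f = maybe′ f false (nth steps v)

  atStep-true : ∀ {v f} → atStep v f ≡ true → ∃ λ x → nth steps v ≡ just x × f x ≡ true
  atStep-true {v} e with nth steps v
  ... | just x = x , refl , e

  atStep-just : ∀ {v x} f → nth steps v ≡ just x → atStep v f ≡ f x
  atStep-just f eq rewrite eq = refl

  -- point v < m stands for the row of the v-th step, point w + 1 for the column of the w-th step
  usesStepRow : ℕ → Rect r c → Bool
  usesStepRow v R = atStep v (λ x → lookup (rowsOf R) (proj₁ x))

  usesStepCol : ℕ → Rect r c → Bool
  usesStepCol zero    R = false
  usesStepCol (suc w) R = atStep w (λ y → lookup (colsOf R) (proj₂ y))

  cover⇒staircaseCover : ∀ {k} {Cov : List (Rect r c)} → Covers Y Cov →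
    (∀ s → rowUsage Cov s ≤ k) → (∀ t → colUsage Cov t ≤ k) →
    StaircaseCover Cov usesStepRow usesStepCol 0 (suc (length steps)) k k
  cover⇒staircaseCover {k} {Cov} (inside , covered) rowLoad colLoad = record
    { left<right = left<right
    ; cover      = cover
    ; left-load  = λ {v} _ _ → left-load v
    ; right-load = λ {w} _ _ → right-load w
    }
    where
    left<right : ∀ {R v w} → R ∈ Cov → usesStepRow v R ≡ true → usesStepCol w R ≡ true → v < w
    left<right {R} {v} {suc w} R∈ usesRow usesCol
      with x , xᵥ , s∈R ← atStep-true usesRow | y , y_w , t∈R ← atStep-true {w} usesCol
      = subst₂ _<_ (rowRank-nth steps-descending v xᵥ) (colRank-nth steps-descending w y_w)
          (cell⇒rank< (trans (cell-toℕ _ _) (inside R R∈ _ _ (lookup⇒[]= _ _ s∈R) (lookup⇒[]= _ _ t∈R))))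

    cover : ∀ {v w} → 0 ≤ v → v < w → w < suc (length steps) →
            ∃ λ R → R ∈ Cov × usesStepRow v R ≡ true × usesStepCol w R ≡ true
    cover {v} {suc w} _ v<1+w 1+w<1+m
      with x , xᵥ ← nth-just steps (≤-<-trans (s≤s⁻¹ v<1+w) (s≤s⁻¹ 1+w<1+m))
         | y , y_w ← nth-just steps (s≤s⁻¹ 1+w<1+m)
      with R , R∈ , s∈R , t∈R ← covered (proj₁ x) (proj₂ y) (trans (sym (cell-toℕ _ _)) (rank<⇒cell
             (subst₂ _<_ (sym (rowRank-nth steps-descending v xᵥ)) (sym (colRank-nth steps-descending w y_w)) v<1+w)))
      = R , R∈ , trans (atStep-just _ xᵥ) ([]=⇒lookup s∈R) , trans (atStep-just _ y_w) ([]=⇒lookup t∈R)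

    left-load : ∀ v → count (usesStepRow v) Cov ≤ k
    left-load v with nth steps v
    ... | just x  = rowLoad (proj₁ x)
    ... | nothing = subst (_≤ k) (sym (count≡0 Cov λ _ ())) z≤n

    right-load : ∀ w → count (usesStepCol w) Cov ≤ k
    right-load zero = subst (_≤ k) (sym (count≡0 Cov λ _ ())) z≤n
    right-load (suc w) with nth steps w
    ... | just y  = colLoad (proj₂ y)
    ... | nothing = subst (_≤ k) (sym (count≡0 Cov λ _ ())) z≤n

_≟ᴿ_ : ∀ {r c} → DecidableEquality (Rect r c)
(S ⊠ T) ≟ᴿ (S′ ⊠ T′) with ≡-dec _≟ᵇ_ S S′ | ≡-dec _≟ᵇ_ T T′
... | yes refl | yes refl = yes refl
... | no S≢S′  | _        = no λ { refl → S≢S′ refl }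
... | yes _    | no T≢T′  = no λ { refl → T≢T′ refl }

module StaircaseToCover {r c : ℕ} (Y : Shape r c) (young : IsYoung Y) (k : ℕ) where
  open YoungDiagram Y young
  open StaircaseCover (blocks-staircaseCover k k 0)

  toRect : Block → Rect r c
  toRect x = tabulate (λ s → blockLeft (rowRank (toℕ s) steps) x) ⊠ tabulate (λ t → blockRight (colRank (toℕ t) steps) x)

  rectangles : List (Rect r c)
  rectangles = deduplicate _≟ᴿ_ (map toRect (blocks k k 0))

  rectangles-unique : Unique rectangles
  rectangles-unique = deduplicate-! _≟ᴿ_ (map toRect (blocks k k 0))

  rectangles-cover : length steps < (k + k) C k → Covers Y rectangles
  rectangles-cover m<C = inside , covered
    where
    inside : ∀ R → R ∈ rectangles → RectIn Y R
    inside R R∈ s t s∈R t∈R with x , x∈ , refl ← ∈-map⁻ toRect (Anyₚ.deduplicate⁻ _≟ᴿ_ R∈) =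
      trans (sym (cell-toℕ s t)) (rank<⇒cell (left<right x∈
        (trans (sym (lookup∘tabulate _ s)) ([]=⇒lookup s∈R))
        (trans (sym (lookup∘tabulate _ t)) ([]=⇒lookup t∈R))))

    covered : ∀ s t → Y s t ≡ true → ∃ λ R → R ∈ rectangles × s ∈ˢ rowsOf R × t ∈ˢ colsOf R
    covered s t inY =
      let x , x∈ , lx , rx = cover z≤n (cell⇒rank< (trans (cell-toℕ s t) inY))
                                       (≤-<-trans (colRank≤length (toℕ t) steps) m<C)
      in  toRect x , Anyₚ.deduplicate⁺ _≟ᴿ_ (λ { refl R∈ → R∈ }) (∈-map⁺ toRect x∈) ,
          lookup⇒[]= s _ (trans (lookup∘tabulate _ s) lx) , lookup⇒[]= t _ (trans (lookup∘tabulate _ t) rx)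

  rectangles-rowUsage : ∀ s → rowUsage rectangles s ≤ k
  rectangles-rowUsage s = begin
    rowUsage rectangles s                                           ≤⟨ count-deduplicate _≟ᴿ_ _ (map toRect (blocks k k 0)) ⟩
    count (λ R → lookup (rowsOf R) s) (map toRect (blocks k k 0))   ≡⟨ count-map _ toRect (blocks k k 0) ⟩
    count (λ x → lookup (rowsOf (toRect x)) s) (blocks k k 0)       ≡⟨ count-≗ (λ x → lookup∘tabulate _ s) (blocks k k 0) ⟩
    count (blockLeft (rowRank (toℕ s) steps)) (blocks k k 0)        ≤⟨ blocks-left-load k k 0 _ ⟩
    k                                                               ∎
    where open ≤-Reasoning

  rectangles-colUsage : ∀ t → colUsage rectangles t ≤ k
  rectangles-colUsage t = begin
    colUsage rectangles t                                           ≤⟨ count-deduplicate _≟ᴿ_ _ (map toRect (blocks k k 0)) ⟩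
    count (λ R → lookup (colsOf R) t) (map toRect (blocks k k 0))   ≡⟨ count-map _ toRect (blocks k k 0) ⟩
    count (λ x → lookup (colsOf (toRect x)) t) (blocks k k 0)       ≡⟨ count-≗ (λ x → lookup∘tabulate _ t) (blocks k k 0) ⟩
    count (blockRight (colRank (toℕ t) steps)) (blocks k k 0)       ≤⟨ blocks-right-load k k 0 _ ⟩
    k                                                               ∎
    where open ≤-Reasoning

theorem1 : (k : ℕ) → .{{_ : NonZero k}} → (r c : ℕ) → (Y : Shape r c) → IsYoung Y →
    (∃ λ (Cov : List (Rect r c)) → Unique Cov × Covers Y Cov ×
        (∀ (s : Fin r) → rowUsage Cov s ≤ k) × (∀ (t : Fin c) → colUsage Cov t ≤ k))
    ⇔ (numSteps Y < (2 * k) C k)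
theorem1 k r c Y young = mk⇔
  (λ (Cov , _ , covers , rowLoad , colLoad) → subst (numSteps Y <_) k+k≡2k
     (staircaseCover-bound k k (CoverToStaircase.cover⇒staircaseCover Y young covers rowLoad colLoad)))
  (λ m<C → rectangles , rectangles-unique , rectangles-cover (subst (numSteps Y <_) (sym k+k≡2k) m<C) ,
           rectangles-rowUsage , rectangles-colUsage)
  where
  open StaircaseToCover Y young k
  k+k≡2k : (k + k) C k ≡ (2 * k) C k
  k+k≡2k = cong (λ n → (k + n) C k) (sym (+-identityʳ k))
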